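{- For $m\geq0$ let $PM_m(q)=[1]_q[3]_q\cdots[m-1]_q$ if $m$ is even (with $PM_0(q)=1$) and $PM_m(q)=0$ if $m$ is odd. Then for every $n\geq0$ the matrix $(PM_{i+j}(q))_{0\leq i,j\leq n}$ has special Smith normal form $\mathrm{diag}\big(1,q^{\binom12}[1]!_q,q^{\binom22}[2]!_q,\ldots,q^{\binom n2}[n]!_q\big)$ over $\mathbb{Z}[q]$.
   Context: $[k]_q=1+q+\cdots+q^{k-1}$, $[k]!_q=[1]_q\cdots[k]_q$. For an $m\times n$ matrix $A$ over a commutative ring $R$, a matrix $D$ is a special Smith normal form (SSNF) of $A$ over $R$ if there exist $P\in \mathrm{SL}(m,R)$, $Q\in\mathrm{SL}(n,R)$ with $PAQ=D$, $D$ is diagonal, and $d_{ii}$ is a multiple in $R$ of $d_{jj}$ whenever $i\geq j$. -}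

module Defs where

open import Level using (0ℓ)
open import Data.Nat using (ℕ; zero; suc)
open import Data.Nat.Combinatorics using (_C_)
open import Data.Integer as ℤ using (ℤ; +_)
open import Data.List using (List; []; _∷_; map; replicate)
open import Data.Fin using (Fin; zero; suc; toℕ; punchIn; _≟_; _≤_)
open import Data.Product using (Σ; Σ-syntax; _×_)
open import Relation.Binary.PropositionalEquality using (_≡_; _≢_)
open import Relation.Nullary using (yes; no)
open import Algebra.Bundles.Raw using (RawRing)

module LinAlg {c ℓ} (R : RawRing c ℓ) where
  open RawRing R

  Matrix : ℕ → ℕ → Set c
  Matrix m n = Fin m → Fin n → Carrier

  sumFin : ∀ {n} → (Fin n → Carrier) → Carrier
  sumFin {zero}  f = 0#
  sumFin {suc n} f = f zero + sumFin (λ i → f (suc i))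

  _⊗_ : ∀ {m n p} → Matrix m n → Matrix n p → Matrix m p
  (A ⊗ B) i k = sumFin (λ j → A i j * B j k)

  signed : ℕ → Carrier → Carrier
  signed zero    x = x
  signed (suc k) x = - signed k x

  det : ∀ {n} → Matrix n n → Carrier
  det {zero}  M = 1#
  det {suc n} M =
    sumFin (λ j → signed (toℕ j) (M zero j * det (λ i k → M (suc i) (punchIn j k))))

  InSL : ∀ {n} → Matrix n n → Set ℓ
  InSL P = det P ≈ 1#

  _∣R_ : Carrier → Carrier → Set (c Level.⊔ ℓ)
  a ∣R b = Σ[ d ∈ Carrier ] (b ≈ d * a)

  IsDiagonal : ∀ {m n} → Matrix m n → Set ℓ
  IsDiagonal {m} {n} D = ∀ (i : Fin m) (j : Fin n) → toℕ i ≢ toℕ j → D i j ≈ 0#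

  IsSSNF : ∀ {m n} → Matrix m n → Matrix m n → Set (c Level.⊔ ℓ)
  IsSSNF {m} {n} A D =
    Σ[ P ∈ Matrix m m ] Σ[ Q ∈ Matrix n n ]
      InSL P × InSL Q
      × (∀ i j → ((P ⊗ A) ⊗ Q) i j ≈ D i j)
      × IsDiagonal D
      × (∀ (i j : Fin m) (i' j' : Fin n) → toℕ i ≡ toℕ i' → toℕ j ≡ toℕ j'
           → toℕ j Data.Nat.≤ toℕ i → D j j' ∣R D i i')

-- The polynomial ring ℤ[q]: coefficient lists (constant term first)

Poly : Set
Poly = List ℤ

coeff : Poly → ℕ → ℤ
coeff []      _       = + 0
coeff (a ∷ p) zero    = a
coeff (a ∷ p) (suc k) = coeff p k

_≈ₚ_ : Poly → Poly → Set
p ≈ₚ r = ∀ k → coeff p k ≡ coeff r k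

_+ₚ_ : Poly → Poly → Poly
[]      +ₚ r       = r
(a ∷ p) +ₚ []      = a ∷ p
(a ∷ p) +ₚ (b ∷ r) = (a ℤ.+ b) ∷ (p +ₚ r)

-ₚ_ : Poly → Poly
-ₚ p = map ℤ.-_ p

_*ₚ_ : Poly → Poly → Poly
[]      *ₚ r = []
(a ∷ p) *ₚ r = map (a ℤ.*_) r +ₚ (+ 0 ∷ (p *ₚ r))

0ₚ 1ₚ qₚ : Poly
0ₚ = []
1ₚ = + 1 ∷ []
qₚ = + 0 ∷ + 1 ∷ []

ℤ[q] : RawRing 0ℓ 0ℓ
ℤ[q] = record
  { Carrier = Poly ; _≈_ = _≈ₚ_ ; _+_ = _+ₚ_ ; _*_ = _*ₚ_
  ; -_ = -ₚ_ ; 0# = 0ₚ ; 1# = 1ₚ }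

_^ₚ_ : Poly → ℕ → Poly
p ^ₚ zero  = 1ₚ
p ^ₚ suc k = p *ₚ (p ^ₚ k)

qint : ℕ → Poly
qint k = replicate k (+ 1)

qfact : ℕ → Poly
qfact zero    = 1ₚ
qfact (suc k) = qfact k *ₚ qint (suc k)

PM : ℕ → Poly
PM zero          = 1ₚ
PM (suc zero)    = 0ₚ
PM (suc (suc m)) = PM m *ₚ qint (suc m)

PMMatrix : (n : ℕ) → LinAlg.Matrix ℤ[q] (suc n) (suc n)
PMMatrix n i j = PM (toℕ i Data.Nat.+ toℕ j)

targetDiag : (n : ℕ) → LinAlg.Matrix ℤ[q] (suc n) (suc n)
targetDiag n i j with i ≟ j
... | yes _ = (qₚ ^ₚ (toℕ i C 2)) *ₚ qfact (toℕ i)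
... | no  _ = 0ₚ

module Submission where

-- The Hankel matrix (PM_{i+j})_{0≤i,j≤n} is the matrix of moments of a
-- family of orthogonal polynomials, and the proof is the classical
-- combinatorial theory of such moments (Flajolet, Viennot).  Given weights
-- ω₁, ω₂, … in a commutative ring, let paths(l, i) be the total weight of the
-- paths of length l from height 0 to height i with steps ±1 (a down-step
-- from height h weighing ω_h), μ_l = paths(l, 0), Λ_i = ω₁⋯ω_i, and P_i the
-- monic polynomials with P_{i+2} = x P_{i+1} - ω_{i+1} P_i.  Applying the
-- moment functional to x^l P_i gives Λ_i paths(l, i), i.e. L H = diag(Λ) Bᵀ
-- for the Hankel matrix H = (μ_{i+j}), the coefficient matrix L of P₀, …, P_n
-- and B = (paths(l, i)).  Both L and B are unitriangular, so is L B, and as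
-- L H Lᵀ is symmetric this yields  L H Lᵀ = diag(Λ₀, …, Λ_n), where
-- det L = det Lᵀ = 1.  For ω_k = q^{k-1}[k]_q one finds
-- paths(l, i) = [l choose i]_q PM_{l-i}, so μ_m = PM_m and
-- Λ_k = q^{C(k,2)}[k]!_q, and clearly Λ_j ∣ Λ_i for j ≤ i.

open import Defs
open import Level using (0ℓ)
open import Data.Nat as ℕ using (ℕ; zero; suc; _<_; _≤_; _∸_; s≤s; z≤n)
import Data.Nat.Properties as ℕ
open import Data.Nat.Combinatorics using (_C_; nC1≡n; nCk+nC[k+1]≡[n+1]C[k+1])
open import Data.List using ([]; _∷_; map)
open import Data.Fin using (Fin; zero; suc; toℕ; punchIn; _≟_)
open import Data.Fin.Properties using (toℕ<n; toℕ-injective; punchInᵢ≢i)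
open import Data.Product using (_,_)
open import Data.Sum using (_⊎_; inj₁; inj₂)
open import Data.Empty using (⊥-elim)
open import Function using (_∘_; flip)
open import Relation.Binary.PropositionalEquality as ≡ using (_≡_; _≢_)
open import Relation.Binary.Definitions using (tri<; tri≈; tri>)
open import Relation.Nullary using (yes; no)
open import Algebra.Bundles using (CommutativeRing)

∸-step : ∀ l i {d} → l ∸ i ≡ suc d → l ∸ suc i ≡ d
∸-step l i l∸i≡d+1 = ≡.trans (≡.sym (ℕ.pred[m∸n]≡m∸[1+n] l i)) (≡.cong ℕ.pred l∸i≡d+1)

module ZeroTerms {c ℓ} (R : CommutativeRing c ℓ) where
  open CommutativeRing R hiding (zero)
  open import Algebra.Properties.Ring ring using (-0#≈0#)

  plus-zero-term : ∀ {x y z} w → x ≈ y → z ≈ 0# → x + w * z ≈ y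
  plus-zero-term w x≈y z≈0 = trans (+-cong x≈y (trans (*-congˡ z≈0) (zeroʳ w))) (+-identityʳ _)

  minus-zero-term : ∀ {x y z} w → x ≈ y → z ≈ 0# → x - w * z ≈ y
  minus-zero-term w x≈y z≈0 =
    trans (+-cong x≈y (trans (-‿cong (trans (*-congˡ z≈0) (zeroʳ w))) -0#≈0#)) (+-identityʳ _)

module MatrixAlgebra {c ℓ} (R : CommutativeRing c ℓ) where
  open CommutativeRing R hiding (zero)
  open LinAlg rawRing using (Matrix; sumFin; _⊗_; signed; det)
  open import Algebra.Properties.Semiring.Sum semiring
    using (sum; sum-cong-≋; sum-cong-≗; sum-replicate-zero; sum-remove; *-distribʳ-sum; ∑-comm)
  open import Algebra.Properties.Ring ring using (-0#≈0#)
  open import Algebra.Solver.CommutativeMonoid *-commutativeMonoid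
    using (solve; _⊜_; _⊕_)
  open import Relation.Binary.Reasoning.Setoid setoid

  sumFin≡sum : ∀ {n} (f : Fin n → Carrier) → sumFin f ≡ sum f
  sumFin≡sum {zero}  f = ≡.refl
  sumFin≡sum {suc n} f = ≡.cong (f zero +_) (sumFin≡sum (f ∘ suc))

  sum-zero : ∀ {n} (f : Fin n → Carrier) → (∀ i → f i ≈ 0#) → sum f ≈ 0#
  sum-zero {n} f f≈0 = trans (sum-cong-≋ f≈0) (sum-replicate-zero n)

  sum-single : ∀ {n} (f : Fin (suc n) → Carrier) (i : Fin (suc n)) →
               (∀ j → j ≢ i → f j ≈ 0#) → sum f ≈ f i
  sum-single f i others≈0 = begin
    sum f                         ≈⟨ sum-remove {i = i} f ⟩
    f i + sum (f ∘ punchIn i)     ≈⟨ +-congˡ (sum-zero _ (λ j → others≈0 _ (punchInᵢ≢i i j))) ⟩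
    f i + 0#                      ≈⟨ +-identityʳ (f i) ⟩
    f i                           ∎

  ⊗-cong : ∀ {m n p} {A A' : Matrix m n} {B B' : Matrix n p} →
           (∀ i j → A i j ≈ A' i j) → (∀ j k → B j k ≈ B' j k) →
           ∀ i k → (A ⊗ B) i k ≈ (A' ⊗ B') i k
  ⊗-cong {A = A} {A'} {B} {B'} A≈A' B≈B' i k = begin
    sumFin (λ j → A i j * B j k)     ≡⟨ sumFin≡sum (λ j → A i j * B j k) ⟩
    sum (λ j → A i j * B j k)        ≈⟨ sum-cong-≋ (λ j → *-cong (A≈A' i j) (B≈B' j k)) ⟩
    sum (λ j → A' i j * B' j k)      ≡⟨ sumFin≡sum (λ j → A' i j * B' j k) ⟨
    sumFin (λ j → A' i j * B' j k)   ∎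

  congruence-symmetric : ∀ {n} (X Y : Matrix n n) → (∀ i j → Y i j ≈ Y j i) →
                         ∀ i j → ((X ⊗ Y) ⊗ flip X) i j ≈ ((X ⊗ Y) ⊗ flip X) j i
  congruence-symmetric {n} X Y Y-sym i j = begin
    ((X ⊗ Y) ⊗ flip X) i j               ≈⟨ expand i j ⟩
    sum (λ l → sum (λ k → term i j k l)) ≈⟨ ∑-comm (λ l k → term i j k l) ⟩
    sum (λ k → sum (λ l → term i j k l)) ≈⟨ sum-cong-≋ (λ k → sum-cong-≋ (λ l → swap k l)) ⟩
    sum (λ k → sum (λ l → term j i l k)) ≈⟨ expand j i ⟨
    ((X ⊗ Y) ⊗ flip X) j i               ∎
    where
    term : (i j k l : Fin n) → Carrier
    term i j k l = (X i k * Y k l) * X j l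

    expand : ∀ i j → ((X ⊗ Y) ⊗ flip X) i j ≈ sum (λ l → sum (λ k → term i j k l))
    expand i j = begin
      sumFin (λ l → sumFin (λ k → X i k * Y k l) * X j l)  ≡⟨ ≡.trans (sumFin≡sum (λ l → sumFin (λ k → X i k * Y k l) * X j l)) (sum-cong-≗ (λ l → ≡.cong (_* X j l) (sumFin≡sum (λ k → X i k * Y k l)))) ⟩
      sum (λ l → sum (λ k → X i k * Y k l) * X j l)        ≈⟨ sum-cong-≋ (λ l → *-distribʳ-sum (X j l) (λ k → X i k * Y k l)) ⟩
      sum (λ l → sum (λ k → term i j k l))                 ∎

    swap : ∀ k l → term i j k l ≈ term j i l k
    swap k l = begin
      (X i k * Y k l) * X j l ≈⟨ *-congʳ (*-congˡ (Y-sym k l)) ⟩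
      (X i k * Y l k) * X j l ≈⟨ solve 3 (λ a b c → (a ⊕ b) ⊕ c ⊜ (c ⊕ b) ⊕ a) refl (X i k) (Y l k) (X j l) ⟩
      (X j l * Y l k) * X i k ∎

  signed-zero : ∀ k {x} → x ≈ 0# → signed k x ≈ 0#
  signed-zero zero    x≈0 = x≈0
  signed-zero (suc k) x≈0 = trans (-‿cong (signed-zero k x≈0)) -0#≈0#

  minor : ∀ {n} → Matrix (suc n) (suc n) → Fin (suc n) → Matrix n n
  minor M j i k = M (suc i) (punchIn j k)

  det-first-term : ∀ {n} (M : Matrix (suc n) (suc n)) →
                   (∀ j → M zero (suc j) * det (minor M (suc j)) ≈ 0#) →
                   det M ≈ M zero zero * det (minor M zero)
  det-first-term {n} M terms≈0 = begin
    M zero zero * det (minor M zero) + sumFin rest ≡⟨ ≡.cong (M zero zero * det (minor M zero) +_) (sumFin≡sum rest) ⟩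
    M zero zero * det (minor M zero) + sum rest    ≈⟨ +-congˡ (sum-zero rest (λ j → signed-zero (suc (toℕ j)) (terms≈0 j))) ⟩
    M zero zero * det (minor M zero) + 0#          ≈⟨ +-identityʳ _ ⟩
    M zero zero * det (minor M zero)               ∎
    where
    rest : Fin n → Carrier
    rest j = signed (suc (toℕ j)) (M zero (suc j) * det (minor M (suc j)))

  det-zero-column : ∀ {n} (M : Matrix (suc n) (suc n)) → (∀ i → M i zero ≈ 0#) → det M ≈ 0#
  minor-zero-column : ∀ {n} (M : Matrix (suc n) (suc n)) (j : Fin n) →
                      (∀ i → M (suc i) zero ≈ 0#) → det (minor M (suc j)) ≈ 0#

  det-zero-column M col≈0 = begin
    det M                              ≈⟨ det-first-term M (λ j → trans (*-congˡ (minor-zero-column M j (col≈0 ∘ suc))) (zeroʳ _)) ⟩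
    M zero zero * det (minor M zero)   ≈⟨ *-congʳ (col≈0 zero) ⟩
    0# * det (minor M zero)            ≈⟨ zeroˡ _ ⟩
    0#                                 ∎
  minor-zero-column {suc n} M j col≈0 = det-zero-column (minor M (suc j)) col≈0

  det-lower-unitriangular : ∀ {n} (M : Matrix n n) →
    (∀ i j → toℕ i < toℕ j → M i j ≈ 0#) → (∀ i → M i i ≈ 1#) → det M ≈ 1#
  det-lower-unitriangular {zero}  M upper≈0 diag≈1 = refl
  det-lower-unitriangular {suc n} M upper≈0 diag≈1 = begin
    det M                              ≈⟨ det-first-term M (λ j → trans (*-congʳ (upper≈0 zero (suc j) (s≤s z≤n))) (zeroˡ _)) ⟩
    M zero zero * det (minor M zero)   ≈⟨ *-cong (diag≈1 zero) (det-lower-unitriangular (minor M zero)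
                                            (λ i j i<j → upper≈0 (suc i) (suc j) (s≤s i<j)) (λ i → diag≈1 (suc i))) ⟩
    1# * 1#                            ≈⟨ *-identityˡ 1# ⟩
    1#                                 ∎

  det-upper-unitriangular : ∀ {n} (M : Matrix n n) →
    (∀ i j → toℕ j < toℕ i → M i j ≈ 0#) → (∀ i → M i i ≈ 1#) → det M ≈ 1#
  det-upper-unitriangular {zero}  M lower≈0 diag≈1 = refl
  det-upper-unitriangular {suc n} M lower≈0 diag≈1 = begin
    det M                              ≈⟨ det-first-term M (λ j → trans (*-congˡ (minor-zero-column M j (λ i → lower≈0 (suc i) zero (s≤s z≤n)))) (zeroʳ _)) ⟩
    M zero zero * det (minor M zero)   ≈⟨ *-cong (diag≈1 zero) (det-upper-unitriangular (minor M zero)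
                                            (λ i j j<i → lower≈0 (suc i) (suc j) (s≤s j<i)) (λ i → diag≈1 (suc i))) ⟩
    1# * 1#                            ≈⟨ *-identityˡ 1# ⟩
    1#                                 ∎

-- Moments and orthogonal polynomials for arbitrary weights ω₁, ω₂, … (the
-- value ω 0 is never used).
module OrthogonalPolynomials {c ℓ} (R : CommutativeRing c ℓ) (ω : ℕ → CommutativeRing.Carrier R) where
  open CommutativeRing R hiding (zero)
  open LinAlg rawRing using (Matrix; sumFin; _⊗_; _∣R_)
  open MatrixAlgebra R
    using (sumFin≡sum; sum-zero; sum-single; congruence-symmetric; det-lower-unitriangular; det-upper-unitriangular)
  open ZeroTerms R using (plus-zero-term; minus-zero-term)
  open import Algebra.Properties.Semiring.Sum semiring
    using (sum; sum-cong-≋; ∑-distrib-+; *-distribˡ-sum)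
  open import Algebra.Properties.Ring ring using (-‿distribˡ-*; xyx⁻¹≈y)
  open import Algebra.Solver.CommutativeMonoid *-commutativeMonoid
    using (solve; _⊜_; _⊕_; id)
  open import Relation.Binary.Reasoning.Setoid setoid

  -- paths l i is the total weight of the Dyck-type paths of length l from
  -- height 0 to height i (steps ±1, never below 0), a down-step from
  -- height h + 1 having weight ω (h + 1) and an up-step weight 1.
  paths : ℕ → ℕ → Carrier
  paths zero    zero    = 1#
  paths zero    (suc i) = 0#
  paths (suc l) zero    = ω 1 * paths l 1
  paths (suc l) (suc i) = paths l i + ω (suc (suc i)) * paths l (suc (suc i))

  μ : ℕ → Carrier
  μ l = paths l 0

  Λ : ℕ → Carrier
  Λ zero    = 1#
  Λ (suc i) = ω (suc i) * Λ i

  -- Multiplication by x of a coefficient sequence.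
  shift : (ℕ → Carrier) → ℕ → Carrier
  shift f zero    = 0#
  shift f (suc k) = f k

  -- P i k is the coefficient of x^k in the monic orthogonal polynomial
  -- defined by P₀ = 1, P₁ = x, P_{i+2} = x P_{i+1} - ω (i + 1) P_i.
  P : ℕ → ℕ → Carrier
  P zero          zero    = 1#
  P zero          (suc k) = 0#
  P (suc zero)    k       = shift (P zero) k
  P (suc (suc i)) k       = shift (P (suc i)) k - ω (suc i) * P i k

  P-above-degree : ∀ i k → i < k → P i k ≈ 0#
  P-above-degree zero          (suc k)       _           = refl
  P-above-degree (suc zero)    (suc zero)    (s≤s ())
  P-above-degree (suc zero)    (suc (suc k)) _           = refl
  P-above-degree (suc (suc i)) (suc k)       (s≤s i+1<k) =
    minus-zero-term (ω (suc i)) (P-above-degree (suc i) k i+1<k) (P-above-degree i (suc k) (ℕ.<-trans (ℕ.n<1+n i) (ℕ.m<n⇒m<1+n i+1<k)))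

  P-leading : ∀ i → P i i ≈ 1#
  P-leading zero          = refl
  P-leading (suc zero)    = refl
  P-leading (suc (suc i)) = minus-zero-term (ω (suc i)) (P-leading (suc i)) (P-above-degree i (suc (suc i)) (ℕ.m<n⇒m<1+n (ℕ.n<1+n i)))

  paths-too-high : ∀ l i → l < i → paths l i ≈ 0#
  paths-too-high zero    (suc i) _       = refl
  paths-too-high (suc l) (suc i) (s≤s l<i) =
    plus-zero-term (ω (suc (suc i))) (paths-too-high l i l<i) (paths-too-high l (suc (suc i)) (ℕ.m<n⇒m<1+n (ℕ.m<n⇒m<1+n l<i)))

  paths-straight-up : ∀ i → paths i i ≈ 1#
  paths-straight-up zero    = refl
  paths-straight-up (suc i) = plus-zero-term (ω (suc (suc i))) (paths-straight-up i) (paths-too-high i (suc (suc i)) (ℕ.m<n⇒m<1+n (ℕ.n<1+n i)))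

  -- The moment functional, truncated to degrees below N and applied to
  -- x^l times the polynomial with coefficient sequence f.
  moment : ℕ → ℕ → (ℕ → Carrier) → Carrier
  moment N l f = sum {N} (λ k → f (toℕ k) * μ (toℕ k ℕ.+ l))

  moment-shift : ∀ N l f → moment (suc N) l (shift f) ≈ moment N (suc l) f
  moment-shift N l f = begin
    0# * μ l + sum {N} (λ k → f (toℕ k) * μ (suc (toℕ k) ℕ.+ l)) ≈⟨ +-cong (zeroˡ (μ l)) (sum-cong-≋ {N} (λ k → *-congˡ (reflexive (≡.cong μ (≡.sym (ℕ.+-suc (toℕ k) l)))))) ⟩
    0# + moment N (suc l) f                                  ≈⟨ +-identityˡ _ ⟩
    moment N (suc l) f                                       ∎

  moment-linear : ∀ N l f g a → moment N l (λ k → f k - a * g k) ≈ moment N l f - a * moment N l g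
  moment-linear N l f g a = begin
    sum (λ k → (f (toℕ k) - a * g (toℕ k)) * m k)           ≈⟨ sum-cong-≋ (λ k → termwise (f (toℕ k)) (g (toℕ k)) (m k)) ⟩
    sum (λ k → f (toℕ k) * m k + - a * (g (toℕ k) * m k))   ≈⟨ ∑-distrib-+ (λ k → f (toℕ k) * m k) _ ⟩
    moment N l f + sum (λ k → - a * (g (toℕ k) * m k))       ≈⟨ +-congˡ (*-distribˡ-sum (- a) (λ k → g (toℕ k) * m k)) ⟨
    moment N l f + - a * moment N l g                        ≈⟨ +-congˡ (-‿distribˡ-* a _) ⟨
    moment N l f - a * moment N l g                          ∎
    where
    m : Fin N → Carrier
    m k = μ (toℕ k ℕ.+ l)
    termwise : ∀ x y z → (x - a * y) * z ≈ x * z + - a * (y * z)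
    termwise x y z = begin
      (x - a * y) * z          ≈⟨ distribʳ z x (- (a * y)) ⟩
      x * z + - (a * y) * z    ≈⟨ +-congˡ (*-congʳ (-‿distribˡ-* a y)) ⟩
      x * z + (- a * y) * z    ≈⟨ +-congˡ (*-assoc (- a) y z) ⟩
      x * z + - a * (y * z)    ∎

  -- The step of the three-term recurrence in terms of path weights:
  -- Λ_{i+1} (B + ω_{i+2} B') - ω_{i+1} Λ_i B = Λ_{i+2} B'.
  recurrence-step : ∀ u y p w r → (u * y) * (p + w * r) - u * (y * p) ≈ (w * (u * y)) * r
  recurrence-step u y p w r = begin
    (u * y) * (p + w * r) - u * (y * p)                ≈⟨ +-cong (distribˡ (u * y) p (w * r)) (-‿cong (sym (*-assoc u y p))) ⟩
    ((u * y) * p + (u * y) * (w * r)) - (u * y) * p    ≈⟨ xyx⁻¹≈y ((u * y) * p) _ ⟩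
    (u * y) * (w * r)                                  ≈⟨ solve 4 (λ u y w r → (u ⊕ y) ⊕ (w ⊕ r) ⊜ (w ⊕ (u ⊕ y)) ⊕ r) refl u y w r ⟩
    (w * (u * y)) * r                                  ∎

  moment-P : ∀ N i l → i < N → moment N l (P i) ≈ Λ i * paths l i
  moment-P (suc N) zero l _ = begin
    1# * μ l + sum {N} (λ k → 0# * μ (suc (toℕ k) ℕ.+ l)) ≈⟨ +-congˡ (sum-zero {N} _ (λ k → zeroˡ _)) ⟩
    1# * μ l + 0#                                     ≈⟨ +-identityʳ _ ⟩
    1# * μ l                                          ∎
  moment-P (suc (suc N)) (suc zero) l _ = begin
    moment (suc (suc N)) l (shift (P zero)) ≈⟨ moment-shift (suc N) l (P zero) ⟩
    moment (suc N) (suc l) (P zero)         ≈⟨ moment-P (suc N) zero (suc l) (s≤s z≤n) ⟩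
    1# * (ω 1 * paths l 1)                  ≈⟨ solve 2 (λ a b → id ⊕ (a ⊕ b) ⊜ (a ⊕ id) ⊕ b) refl (ω 1) (paths l 1) ⟩
    (ω 1 * 1#) * paths l 1                  ∎
  moment-P (suc N) (suc (suc i)) l (s≤s i+1<N) = begin
    moment (suc N) l (P (suc (suc i)))                                 ≈⟨ moment-linear (suc N) l (shift (P (suc i))) (P i) (ω (suc i)) ⟩
    moment (suc N) l (shift (P (suc i))) - ω (suc i) * moment (suc N) l (P i)
                                                                       ≈⟨ +-cong (moment-shift N l (P (suc i))) (-‿cong (*-congˡ (moment-P (suc N) i l (ℕ.<-trans (ℕ.n<1+n i) (ℕ.m<n⇒m<1+n i+1<N))))) ⟩
    moment N (suc l) (P (suc i)) - ω (suc i) * (Λ i * paths l i)       ≈⟨ +-congʳ (moment-P N (suc i) (suc l) i+1<N) ⟩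
    Λ (suc i) * paths (suc l) (suc i) - ω (suc i) * (Λ i * paths l i)  ≈⟨ recurrence-step (ω (suc i)) (Λ i) (paths l i) (ω (suc (suc i))) (paths l (suc (suc i))) ⟩
    Λ (suc (suc i)) * paths l (suc (suc i))                            ∎

  P-paths-vanish : ∀ j l i → j < l ⊎ l < i → P j l * paths l i ≈ 0#
  P-paths-vanish j l i (inj₁ j<l) = trans (*-congʳ (P-above-degree j l j<l)) (zeroˡ _)
  P-paths-vanish j l i (inj₂ l<i) = trans (*-congˡ (paths-too-high l i l<i)) (zeroʳ _)

  CB : ∀ {N} → Fin N → Fin N → Carrier
  CB {N} j i = sum {N} (λ l → P (toℕ j) (toℕ l) * paths (toℕ l) (toℕ i))

  CB-upper : ∀ {N} (j i : Fin N) → toℕ j < toℕ i → CB j i ≈ 0#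
  CB-upper {N} j i j<i = sum-zero {N} _ (λ l → P-paths-vanish (toℕ j) (toℕ l) (toℕ i) (outside l))
    where
    outside : ∀ l → toℕ j < toℕ l ⊎ toℕ l < toℕ i
    outside l with toℕ l ℕ.≤? toℕ j
    ... | yes l≤j = inj₂ (ℕ.≤-<-trans l≤j j<i)
    ... | no  l≰j = inj₁ (ℕ.≰⇒> l≰j)

  CB-diagonal : ∀ {N} (i : Fin N) → CB i i ≈ 1#
  CB-diagonal {suc N} i = begin
    CB i i                                      ≈⟨ sum-single _ i others ⟩
    P (toℕ i) (toℕ i) * paths (toℕ i) (toℕ i)     ≈⟨ *-cong (P-leading (toℕ i)) (paths-straight-up (toℕ i)) ⟩
    1# * 1#                                       ≈⟨ *-identityˡ 1# ⟩
    1#                                            ∎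
    where
    others : ∀ l → l ≢ i → P (toℕ i) (toℕ l) * paths (toℕ l) (toℕ i) ≈ 0#
    others l l≢i with ℕ.<-cmp (toℕ i) (toℕ l)
    ... | tri< i<l _ _ = P-paths-vanish (toℕ i) (toℕ l) (toℕ i) (inj₁ i<l)
    ... | tri≈ _ i≡l _ = ⊥-elim (l≢i (toℕ-injective (≡.sym i≡l)))
    ... | tri> _ _ l<i = P-paths-vanish (toℕ i) (toℕ l) (toℕ i) (inj₂ l<i)

  coefficientMatrix hankelMatrix : (N : ℕ) → Matrix N N
  coefficientMatrix N i k = P (toℕ i) (toℕ k)
  hankelMatrix      N i j = μ (toℕ i ℕ.+ toℕ j)

  coefficient-hankel : ∀ N (i l : Fin N) →
    (coefficientMatrix N ⊗ hankelMatrix N) i l ≈ Λ (toℕ i) * paths (toℕ l) (toℕ i)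
  coefficient-hankel N i l = begin
    sumFin {N} (λ k → P (toℕ i) (toℕ k) * μ (toℕ k ℕ.+ toℕ l)) ≡⟨ sumFin≡sum {N} (λ k → P (toℕ i) (toℕ k) * μ (toℕ k ℕ.+ toℕ l)) ⟩
    moment N (toℕ l) (P (toℕ i))                            ≈⟨ moment-P N (toℕ i) (toℕ l) (toℕ<n i) ⟩
    Λ (toℕ i) * paths (toℕ l) (toℕ i)                       ∎

  congruence-entry : ∀ N (i j : Fin N) →
    ((coefficientMatrix N ⊗ hankelMatrix N) ⊗ flip (coefficientMatrix N)) i j ≈ Λ (toℕ i) * CB j i
  congruence-entry N i j = begin
    sumFin {N} (λ l → (L ⊗ H) i l * L j l)                      ≡⟨ sumFin≡sum {N} (λ l → (L ⊗ H) i l * L j l) ⟩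
    sum (λ l → (L ⊗ H) i l * L j l)                             ≈⟨ sum-cong-≋ (λ l → *-congʳ (coefficient-hankel N i l)) ⟩
    sum (λ l → (Λ (toℕ i) * paths (toℕ l) (toℕ i)) * L j l)     ≈⟨ sum-cong-≋ (λ l → rearrange (Λ (toℕ i)) _ (L j l)) ⟩
    sum (λ l → Λ (toℕ i) * (L j l * paths (toℕ l) (toℕ i)))     ≈⟨ *-distribˡ-sum (Λ (toℕ i)) (λ l → L j l * paths (toℕ l) (toℕ i)) ⟨
    Λ (toℕ i) * CB j i                                        ∎
    where
    L H : Matrix N N
    L = coefficientMatrix N
    H = hankelMatrix N
    rearrange : ∀ a b c → (a * b) * c ≈ a * (c * b)
    rearrange = solve 3 (λ a b c → (a ⊕ b) ⊕ c ⊜ a ⊕ (c ⊕ b)) refl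

  -- Hence C H Cᵀ = diag(Λ₀, …, Λ_{N-1}): entry (i, j) is Λ_i (C B)_{ji}, which
  -- vanishes below the diagonal as C B is lower unitriangular, and above it
  -- because C H Cᵀ is symmetric.
  congruence-diagonal : ∀ N (i : Fin N) →
    ((coefficientMatrix N ⊗ hankelMatrix N) ⊗ flip (coefficientMatrix N)) i i ≈ Λ (toℕ i)
  congruence-diagonal N i =
    trans (congruence-entry N i i) (trans (*-congˡ (CB-diagonal i)) (*-identityʳ _))

  congruence-off-diagonal : ∀ N (i j : Fin N) → toℕ i ≢ toℕ j →
    ((coefficientMatrix N ⊗ hankelMatrix N) ⊗ flip (coefficientMatrix N)) i j ≈ 0#
  congruence-off-diagonal N i j i≢j with ℕ.<-cmp (toℕ i) (toℕ j)
  ... | tri< i<j _ _ = begin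
    _                        ≈⟨ congruence-symmetric (coefficientMatrix N) (hankelMatrix N) hankel-symmetric i j ⟩
    _                        ≈⟨ congruence-entry N j i ⟩
    Λ (toℕ j) * CB i j     ≈⟨ *-congˡ (CB-upper i j i<j) ⟩
    Λ (toℕ j) * 0#           ≈⟨ zeroʳ _ ⟩
    0#                       ∎
    where
    hankel-symmetric : ∀ k l → hankelMatrix N k l ≈ hankelMatrix N l k
    hankel-symmetric k l = reflexive (≡.cong μ (ℕ.+-comm (toℕ k) (toℕ l)))
  ... | tri≈ _ i≡j _ = ⊥-elim (i≢j i≡j)
  ... | tri> _ _ j<i = begin
    _                        ≈⟨ congruence-entry N i j ⟩
    Λ (toℕ i) * CB j i     ≈⟨ *-congˡ (CB-upper j i j<i) ⟩
    Λ (toℕ i) * 0#           ≈⟨ zeroʳ _ ⟩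
    0#                       ∎

  Λ-extend : ∀ e b → Λ b ∣R Λ (e ℕ.+ b)
  Λ-extend zero    b = 1# , sym (*-identityˡ (Λ b))
  Λ-extend (suc e) b with Λ-extend e b
  ... | d , Λe+b≈dΛb = ω (suc (e ℕ.+ b)) * d , trans (*-congˡ Λe+b≈dΛb) (sym (*-assoc _ d (Λ b)))

  Λ-divides : ∀ {a b} → b ≤ a → Λ b ∣R Λ a
  Λ-divides {a} {b} b≤a = ≡.subst (λ x → Λ b ∣R Λ x) (ℕ.m∸n+n≡m b≤a) (Λ-extend (a ∸ b) b)

  coefficientMatrix-det : ∀ N → LinAlg.InSL rawRing (coefficientMatrix N)
  coefficientMatrix-det N = det-lower-unitriangular (coefficientMatrix N)
    (λ i k i<k → P-above-degree (toℕ i) (toℕ k) i<k) (λ i → P-leading (toℕ i))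

  coefficientMatrixᵀ-det : ∀ N → LinAlg.InSL rawRing (flip (coefficientMatrix N))
  coefficientMatrixᵀ-det N = det-upper-unitriangular (flip (coefficientMatrix N))
    (λ k i i<k → P-above-degree (toℕ i) (toℕ k) i<k) (λ i → P-leading (toℕ i))

module QHermiteMoments {c ℓ} (R : CommutativeRing c ℓ) (q : CommutativeRing.Carrier R) where
  open CommutativeRing R hiding (zero)
  open import Algebra.Properties.Semiring.Exp semiring using (_^_; ^-homo-*)
  open import Algebra.Solver.CommutativeMonoid *-commutativeMonoid
    using (solve; _⊜_; _⊕_; id)
  open import Relation.Binary.Reasoning.Setoid setoid

  [_] : ℕ → Carrier
  [ zero  ] = 0#
  [ suc k ] = 1# + q * [ k ]

  [1]≈1 : [ 1 ] ≈ 1#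
  [1]≈1 = trans (+-congˡ (zeroʳ q)) (+-identityʳ 1#)

  [+] : ∀ a b → [ a ℕ.+ b ] ≈ [ a ] + q ^ a * [ b ]
  [+] zero    b = sym (trans (+-identityˡ _) (*-identityˡ _))
  [+] (suc a) b = begin
    1# + q * [ a ℕ.+ b ]                  ≈⟨ +-congˡ (*-congˡ ([+] a b)) ⟩
    1# + q * ([ a ] + q ^ a * [ b ])      ≈⟨ +-congˡ (distribˡ q [ a ] _) ⟩
    1# + (q * [ a ] + q * (q ^ a * [ b ]))  ≈⟨ +-congˡ (+-congˡ (sym (*-assoc q (q ^ a) [ b ]))) ⟩
    1# + (q * [ a ] + q ^ suc a * [ b ])  ≈⟨ +-assoc 1# _ _ ⟨
    [ suc a ] + q ^ suc a * [ b ]         ∎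

  [_]! : ℕ → Carrier
  [ zero  ]! = 1#
  [ suc k ]! = [ k ]! * [ suc k ]

  PMq : ℕ → Carrier
  PMq zero          = 1#
  PMq (suc zero)    = 0#
  PMq (suc (suc m)) = PMq m * [ suc m ]

  qweight : ℕ → Carrier
  qweight zero    = 0#
  qweight (suc k) = q ^ k * [ suc k ]

  open OrthogonalPolynomials R qweight public
  open ZeroTerms R using (plus-zero-term)

  binom : ℕ → ℕ → Carrier
  binom zero    zero    = 1#
  binom zero    (suc k) = 0#
  binom (suc n) zero    = 1#
  binom (suc n) (suc k) = binom n k + q ^ suc k * binom n (suc k)

  binom-zero : ∀ n → binom n 0 ≈ 1#
  binom-zero zero    = refl
  binom-zero (suc n) = refl

  binom-above : ∀ n k → n < k → binom n k ≈ 0#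
  binom-above zero    (suc k) _         = refl
  binom-above (suc n) (suc k) (s≤s n<k) =
    plus-zero-term (q ^ suc k) (binom-above n k n<k) (binom-above n (suc k) (ℕ.m<n⇒m<1+n n<k))

  binom-one : ∀ n → binom n 1 ≈ [ n ]
  binom-one zero    = refl
  binom-one (suc n) = +-cong (binom-zero n) (*-cong (*-identityʳ q) (binom-one n))

  binom-absorb : ∀ n k → [ suc k ] * binom n (suc k) ≈ [ n ∸ k ] * binom n k
  binom-absorb zero    zero    = trans (zeroʳ _) (sym (zeroˡ _))
  binom-absorb zero    (suc k) = trans (zeroʳ _) (sym (zeroˡ _))
  binom-absorb (suc n) zero    = begin
    [ 1 ] * binom (suc n) 1     ≈⟨ *-cong [1]≈1 (binom-one (suc n)) ⟩
    1# * [ suc n ]              ≈⟨ *-comm 1# _ ⟩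
    [ suc n ] * 1#              ∎
  binom-absorb (suc n) (suc k) with n ℕ.≤? k
  ... | yes n≤k = begin
    [ suc (suc k) ] * binom (suc n) (suc (suc k)) ≈⟨ *-congˡ (binom-above (suc n) (suc (suc k)) (s≤s (s≤s n≤k))) ⟩
    [ suc (suc k) ] * 0#                          ≈⟨ zeroʳ _ ⟩
    0#                                            ≈⟨ zeroˡ _ ⟨
    [ 0 ] * binom (suc n) (suc k)                 ≡⟨ ≡.cong (λ d → [ d ] * binom (suc n) (suc k)) (ℕ.m≤n⇒m∸n≡0 n≤k) ⟨
    [ n ∸ k ] * binom (suc n) (suc k)             ∎
  ... | no n≰k = begin
    [ k+2 ] * (binom n (suc k) + q ^ k+2 * binom n k+2)      ≈⟨ spread [ k+2 ] _ (q ^ k+2) _ ⟩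
    [ k+2 ] * t + q ^ k+2 * ([ k+2 ] * binom n k+2)          ≈⟨ +-congˡ (*-congˡ (binom-absorb n (suc k))) ⟩
    [ k+2 ] * t + q ^ k+2 * ([ n ∸ suc k ] * t)              ≈⟨ collect k+2 (n ∸ suc k) (≡.cong suc (ℕ.m+[n∸m]≡n k<n)) ⟩
    [ suc n ] * t                                            ≈⟨ collect (suc k) (n ∸ k) (≡.cong suc (ℕ.m+[n∸m]≡n (ℕ.<⇒≤ k<n))) ⟨
    [ suc k ] * t + q ^ suc k * ([ n ∸ k ] * t)              ≈⟨ +-congʳ (binom-absorb n k) ⟩
    [ n ∸ k ] * binom n k + q ^ suc k * ([ n ∸ k ] * t)      ≈⟨ spread [ n ∸ k ] _ (q ^ suc k) _ ⟨
    [ n ∸ k ] * (binom n k + q ^ suc k * t)                  ∎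
    where
    k+2 = suc (suc k)
    t = binom n (suc k)
    k<n : k < n
    k<n = ℕ.≰⇒> n≰k
    spread : ∀ a x p y → a * (x + p * y) ≈ a * x + p * (a * y)
    spread a x p y = trans (distribˡ a x (p * y)) (+-congˡ (solve 3 (λ a p y → a ⊕ (p ⊕ y) ⊜ p ⊕ (a ⊕ y)) refl a p y))
    collect : ∀ a b → a ℕ.+ b ≡ suc n → [ a ] * t + q ^ a * ([ b ] * t) ≈ [ suc n ] * t
    collect a b a+b≡n+1 = begin
      [ a ] * t + q ^ a * ([ b ] * t)  ≈⟨ +-congˡ (sym (*-assoc (q ^ a) [ b ] t)) ⟩
      [ a ] * t + (q ^ a * [ b ]) * t  ≈⟨ distribʳ t [ a ] _ ⟨
      ([ a ] + q ^ a * [ b ]) * t      ≈⟨ *-congʳ ([+] a b) ⟨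
      [ a ℕ.+ b ] * t                  ≡⟨ ≡.cong (λ m → [ m ] * t) a+b≡n+1 ⟩
      [ suc n ] * t                    ∎

  qweight-1 : qweight 1 ≈ 1#
  qweight-1 = trans (*-identityˡ [ 1 ]) [1]≈1

  descent : ∀ l i → qweight (suc (suc i)) * (binom l (suc (suc i)) * PMq (l ∸ suc (suc i)))
                    ≈ (q ^ suc i * binom l (suc i)) * PMq (l ∸ i)
  descent l i with l ∸ i in l∸i≡
  ... | zero = begin
    qweight (suc (suc i)) * (binom l (suc (suc i)) * _)
                                         ≈⟨ *-congˡ (*-congʳ (binom-above l (suc (suc i)) (ℕ.m<n⇒m<1+n l<i+1))) ⟩
    qweight (suc (suc i)) * (0# * _)     ≈⟨ trans (*-congˡ (zeroˡ _)) (zeroʳ _) ⟩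
    0#                                   ≈⟨ trans (*-congˡ (binom-above l (suc i) l<i+1)) (zeroʳ _) ⟨
    q ^ suc i * binom l (suc i)          ≈⟨ *-identityʳ _ ⟨
    (q ^ suc i * binom l (suc i)) * 1#   ∎
    where
    l<i+1 : l < suc i
    l<i+1 = s≤s (ℕ.m∸n≡0⇒m≤n l∸i≡)
  ... | suc zero = begin
    qweight (suc (suc i)) * (binom l (suc (suc i)) * _)
                                         ≈⟨ *-congˡ (*-congʳ (binom-above l (suc (suc i)) (s≤s (ℕ.m∸n≡0⇒m≤n (∸-step l i l∸i≡))))) ⟩
    qweight (suc (suc i)) * (0# * _)     ≈⟨ trans (*-congˡ (zeroˡ _)) (zeroʳ _) ⟩
    0#                                   ≈⟨ zeroʳ _ ⟨
    (q ^ suc i * binom l (suc i)) * 0#   ∎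
  ... | suc (suc m) = begin
    (q ^ suc i * [ i+2 ]) * (binom l i+2 * PMq (l ∸ i+2))     ≈⟨ solve 4 (λ a b c d → (a ⊕ b) ⊕ (c ⊕ d) ⊜ a ⊕ ((b ⊕ c) ⊕ d)) refl (q ^ suc i) [ i+2 ] _ _ ⟩
    q ^ suc i * (([ i+2 ] * binom l i+2) * PMq (l ∸ i+2))     ≈⟨ *-congˡ (*-cong (binom-absorb l (suc i)) (reflexive (≡.cong PMq l∸i+2≡m))) ⟩
    q ^ suc i * (([ l ∸ suc i ] * binom l (suc i)) * PMq m)   ≡⟨ ≡.cong (λ d → q ^ suc i * (([ d ] * binom l (suc i)) * PMq m)) l∸i+1≡m+1 ⟩
    q ^ suc i * (([ suc m ] * binom l (suc i)) * PMq m)       ≈⟨ solve 4 (λ a b c d → a ⊕ ((b ⊕ c) ⊕ d) ⊜ (a ⊕ c) ⊕ (d ⊕ b)) refl (q ^ suc i) [ suc m ] _ _ ⟩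
    (q ^ suc i * binom l (suc i)) * (PMq m * [ suc m ])       ∎
    where
    i+2 = suc (suc i)
    l∸i+1≡m+1 = ∸-step l i l∸i≡
    l∸i+2≡m = ∸-step l (suc i) l∸i+1≡m+1

  paths-closed : ∀ l i → paths l i ≈ binom l i * PMq (l ∸ i)
  paths-closed zero          zero    = sym (*-identityˡ 1#)
  paths-closed zero          (suc i) = sym (zeroˡ _)
  paths-closed (suc zero)    zero    = trans (zeroʳ _) (sym (zeroʳ _))
  paths-closed (suc (suc l)) zero    = begin
    qweight 1 * paths (suc l) 1     ≈⟨ *-cong qweight-1 (paths-closed (suc l) 1) ⟩
    1# * (binom (suc l) 1 * PMq l)  ≈⟨ *-congˡ (*-congʳ (binom-one (suc l))) ⟩
    1# * ([ suc l ] * PMq l)        ≈⟨ *-congˡ (*-comm _ _) ⟩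
    1# * (PMq l * [ suc l ])        ∎
  paths-closed (suc l)       (suc i) = begin
    paths l i + qweight (suc (suc i)) * paths l (suc (suc i))
      ≈⟨ +-cong (paths-closed l i) (*-congˡ (paths-closed l (suc (suc i)))) ⟩
    binom l i * PMq (l ∸ i) + qweight (suc (suc i)) * (binom l (suc (suc i)) * PMq (l ∸ suc (suc i)))
      ≈⟨ +-congˡ (descent l i) ⟩
    binom l i * PMq (l ∸ i) + (q ^ suc i * binom l (suc i)) * PMq (l ∸ i)
      ≈⟨ distribʳ _ _ _ ⟨
    (binom l i + q ^ suc i * binom l (suc i)) * PMq (l ∸ i) ∎

  μ-closed : ∀ l → μ l ≈ PMq l
  μ-closed l = trans (paths-closed l 0) (trans (*-congʳ (binom-zero l)) (*-identityˡ _))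

  Λ-closed : ∀ i → Λ i ≈ q ^ (i C 2) * [ i ]!
  Λ-closed zero    = sym (*-identityˡ 1#)
  Λ-closed (suc i) = begin
    (q ^ i * [ suc i ]) * Λ i                       ≈⟨ *-congˡ (Λ-closed i) ⟩
    (q ^ i * [ suc i ]) * (q ^ (i C 2) * [ i ]!)    ≈⟨ solve 4 (λ a b c d → (a ⊕ b) ⊕ (c ⊕ d) ⊜ (a ⊕ c) ⊕ (d ⊕ b)) refl (q ^ i) [ suc i ] _ _ ⟩
    (q ^ i * q ^ (i C 2)) * [ suc i ]!              ≈⟨ *-congʳ (^-homo-* q i (i C 2)) ⟨
    q ^ (i ℕ.+ i C 2) * [ suc i ]!                  ≡⟨ ≡.cong (λ e → q ^ e * [ suc i ]!) i+iC2≡[i+1]C2 ⟩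
    q ^ (suc i C 2) * [ suc i ]!                    ∎
    where
    i+iC2≡[i+1]C2 : i ℕ.+ i C 2 ≡ suc i C 2
    i+iC2≡[i+1]C2 = ≡.trans (≡.cong (ℕ._+ i C 2) (≡.sym (nC1≡n i))) (nCk+nC[k+1]≡[n+1]C[k+1] i 1)

module PolynomialRing where
  open import Data.Integer as ℤ using (ℤ; +_)
  import Data.Integer.Properties as ℤ
  open import Relation.Binary.Bundles using (Setoid)
  open import Relation.Binary.Structures using (IsEquivalence)
  open import Algebra.Structures _≈ₚ_ using (IsCommutativeRing)
  open import Algebra.Definitions _≈ₚ_

  infixr 25 _·_
  _·_ : ℤ → Poly → Poly
  a · p = map (a ℤ.*_) p

  coeff-+ : ∀ p r k → coeff (p +ₚ r) k ≡ coeff p k ℤ.+ coeff r k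
  coeff-+ []      r       k       = ≡.sym (ℤ.+-identityˡ (coeff r k))
  coeff-+ (a ∷ p) []      k       = ≡.sym (ℤ.+-identityʳ (coeff (a ∷ p) k))
  coeff-+ (a ∷ p) (b ∷ r) zero    = ≡.refl
  coeff-+ (a ∷ p) (b ∷ r) (suc k) = coeff-+ p r k

  coeff-neg : ∀ p k → coeff (-ₚ p) k ≡ ℤ.- coeff p k
  coeff-neg []      k       = ≡.refl
  coeff-neg (a ∷ p) zero    = ≡.refl
  coeff-neg (a ∷ p) (suc k) = coeff-neg p k

  coeff-· : ∀ a p k → coeff (a · p) k ≡ a ℤ.* coeff p k
  coeff-· a []      k       = ≡.sym (ℤ.*-zeroʳ a)
  coeff-· a (b ∷ p) zero    = ≡.refl
  coeff-· a (b ∷ p) (suc k) = coeff-· a p k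

  ≈ₚ-refl : ∀ {p} → p ≈ₚ p
  ≈ₚ-refl k = ≡.refl

  ≈ₚ-sym : ∀ {p r} → p ≈ₚ r → r ≈ₚ p
  ≈ₚ-sym p≈r k = ≡.sym (p≈r k)

  ≈ₚ-trans : ∀ {p r s} → p ≈ₚ r → r ≈ₚ s → p ≈ₚ s
  ≈ₚ-trans p≈r r≈s k = ≡.trans (p≈r k) (r≈s k)

  ≈ₚ-isEquivalence : IsEquivalence _≈ₚ_
  ≈ₚ-isEquivalence = record { refl = λ {p} → ≈ₚ-refl {p} ; sym = λ {p r} → ≈ₚ-sym {p} {r} ; trans = λ {p r s} → ≈ₚ-trans {p} {r} {s} }

  polySetoid : Setoid 0ℓ 0ℓ
  polySetoid = record { isEquivalence = ≈ₚ-isEquivalence }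

  import Algebra.Consequences.Setoid polySetoid as Consequences

  module _ where
    open ≡.≡-Reasoning

    +-cong : Congruent₂ _+ₚ_
    +-cong {p} {p'} {r} {r'} p≈p' r≈r' k =
      ≡.trans (coeff-+ p r k) (≡.trans (≡.cong₂ ℤ._+_ (p≈p' k) (r≈r' k)) (≡.sym (coeff-+ p' r' k)))

    +-assoc : Associative _+ₚ_
    +-assoc p r s k = begin
      coeff ((p +ₚ r) +ₚ s) k                  ≡⟨ ≡.trans (coeff-+ (p +ₚ r) s k) (≡.cong (ℤ._+ coeff s k) (coeff-+ p r k)) ⟩
      (coeff p k ℤ.+ coeff r k) ℤ.+ coeff s k  ≡⟨ ℤ.+-assoc (coeff p k) (coeff r k) (coeff s k) ⟩
      coeff p k ℤ.+ (coeff r k ℤ.+ coeff s k)  ≡⟨ ≡.trans (coeff-+ p (r +ₚ s) k) (≡.cong (λ x → coeff p k ℤ.+ x) (coeff-+ r s k)) ⟨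
      coeff (p +ₚ (r +ₚ s)) k                  ∎

    +-comm : Commutative _+ₚ_
    +-comm p r k = ≡.trans (coeff-+ p r k) (≡.trans (ℤ.+-comm (coeff p k) (coeff r k)) (≡.sym (coeff-+ r p k)))

    +-identityˡ : LeftIdentity 0ₚ _+ₚ_
    +-identityˡ p = ≈ₚ-refl {p}

    -‿cong : Congruent₁ -ₚ_
    -‿cong {p} {r} p≈r k = ≡.trans (coeff-neg p k) (≡.trans (≡.cong ℤ.-_ (p≈r k)) (≡.sym (coeff-neg r k)))

    -‿inverseˡ : LeftInverse 0ₚ -ₚ_ _+ₚ_
    -‿inverseˡ p k = ≡.trans (coeff-+ (-ₚ p) p k) (≡.trans (≡.cong (ℤ._+ coeff p k) (coeff-neg p k)) (ℤ.+-inverseˡ (coeff p k)))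

    +-middleFour : _+ₚ_ MiddleFourExchange _+ₚ_
    +-middleFour = Consequences.comm∧assoc⇒middleFour {_+ₚ_} (λ {p p' r r'} → +-cong {p} {p'} {r} {r'}) +-comm +-assoc

    ·-cong : ∀ a {p r} → p ≈ₚ r → a · p ≈ₚ a · r
    ·-cong a {p} {r} p≈r k = ≡.trans (coeff-· a p k) (≡.trans (≡.cong (a ℤ.*_) (p≈r k)) (≡.sym (coeff-· a r k)))

    ·-+ : ∀ a p r → a · (p +ₚ r) ≈ₚ (a · p +ₚ a · r)
    ·-+ a p r k = begin
      coeff (a · (p +ₚ r)) k                        ≡⟨ ≡.trans (coeff-· a (p +ₚ r) k) (≡.cong (a ℤ.*_) (coeff-+ p r k)) ⟩
      a ℤ.* (coeff p k ℤ.+ coeff r k)               ≡⟨ ℤ.*-distribˡ-+ a (coeff p k) (coeff r k) ⟩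
      a ℤ.* coeff p k ℤ.+ a ℤ.* coeff r k           ≡⟨ ≡.trans (coeff-+ (a · p) (a · r) k) (≡.cong₂ ℤ._+_ (coeff-· a p k) (coeff-· a r k)) ⟨
      coeff (a · p +ₚ a · r) k                      ∎

    0· : ∀ p → (+ 0) · p ≈ₚ 0ₚ
    0· p k = coeff-· (+ 0) p k

    1· : ∀ p → (+ 1) · p ≈ₚ p
    1· p k = ≡.trans (coeff-· (+ 1) p k) (ℤ.*-identityˡ (coeff p k))

    *-identityˡ : LeftIdentity 1ₚ _*ₚ_
    *-identityˡ p k = begin
      coeff ((+ 1) · p +ₚ (+ 0 ∷ [])) k          ≡⟨ coeff-+ ((+ 1) · p) (+ 0 ∷ []) k ⟩
      coeff ((+ 1) · p) k ℤ.+ coeff (+ 0 ∷ []) k  ≡⟨ ≡.cong₂ ℤ._+_ (1· p k) (coeff-zero k) ⟩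
      coeff p k ℤ.+ + 0                          ≡⟨ ℤ.+-identityʳ (coeff p k) ⟩
      coeff p k                                  ∎
      where
      coeff-zero : ∀ k → coeff (+ 0 ∷ []) k ≡ + 0
      coeff-zero zero    = ≡.refl
      coeff-zero (suc k) = ≡.refl

    ·-· : ∀ a b p → a · (b · p) ≈ₚ (a ℤ.* b) · p
    ·-· a b p k = begin
      coeff (a · (b · p)) k         ≡⟨ ≡.trans (coeff-· a (b · p) k) (≡.cong (a ℤ.*_) (coeff-· b p k)) ⟩
      a ℤ.* (b ℤ.* coeff p k)       ≡⟨ ℤ.*-assoc a b (coeff p k) ⟨
      (a ℤ.* b) ℤ.* coeff p k       ≡⟨ coeff-· (a ℤ.* b) p k ⟨
      coeff ((a ℤ.* b) · p) k       ∎

  module _ where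
    open import Relation.Binary.Reasoning.Setoid polySetoid

    cons-cong : ∀ {a b p r} → a ≡ b → p ≈ₚ r → (a ∷ p) ≈ₚ (b ∷ r)
    cons-cong a≡b p≈r zero    = a≡b
    cons-cong a≡b p≈r (suc k) = p≈r k

    *-congʳ : ∀ p {r r'} → r ≈ₚ r' → (p *ₚ r) ≈ₚ (p *ₚ r')
    *-congʳ []      r≈r' = ≈ₚ-refl {[]}
    *-congʳ (a ∷ p) {r} {r'} r≈r' =
      +-cong {a · r} {a · r'} {+ 0 ∷ (p *ₚ r)} {+ 0 ∷ (p *ₚ r')} (·-cong a {r} {r'} r≈r') (cons-cong ≡.refl (*-congʳ p r≈r'))

    *-zeroʳ : ∀ p → (p *ₚ []) ≈ₚ []
    *-zeroʳ []      = ≈ₚ-refl {[]}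
    *-zeroʳ (a ∷ p) = λ { zero → ≡.refl ; (suc k) → *-zeroʳ p k }

    *-cons : ∀ p b r → (p *ₚ (b ∷ r)) ≈ₚ (b · p +ₚ (+ 0 ∷ (p *ₚ r)))
    *-cons []      b r = λ { zero → ≡.refl ; (suc k) → ≡.refl }
    *-cons (a ∷ p) b r = cons-cong (≡.cong (ℤ._+ + 0) (ℤ.*-comm a b)) (begin
      a · r +ₚ (p *ₚ (b ∷ r))                   ≈⟨ +-cong {a · r} {a · r} {p *ₚ (b ∷ r)} {b · p +ₚ (+ 0 ∷ (p *ₚ r))} (≈ₚ-refl {a · r}) (*-cons p b r) ⟩
      a · r +ₚ (b · p +ₚ (+ 0 ∷ (p *ₚ r)))       ≈⟨ +-assoc (a · r) (b · p) _ ⟨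
      (a · r +ₚ b · p) +ₚ (+ 0 ∷ (p *ₚ r))       ≈⟨ +-cong {a · r +ₚ b · p} {b · p +ₚ a · r} {+ 0 ∷ (p *ₚ r)} {+ 0 ∷ (p *ₚ r)} (+-comm (a · r) (b · p)) (≈ₚ-refl {+ 0 ∷ (p *ₚ r)}) ⟩
      (b · p +ₚ a · r) +ₚ (+ 0 ∷ (p *ₚ r))       ≈⟨ +-assoc (b · p) (a · r) _ ⟩
      b · p +ₚ (a · r +ₚ (+ 0 ∷ (p *ₚ r)))       ∎)

    *-comm : Commutative _*ₚ_
    *-comm []      r = ≈ₚ-sym {r *ₚ []} {[]} (*-zeroʳ r)
    *-comm (a ∷ p) r = begin
      a · r +ₚ (+ 0 ∷ (p *ₚ r))   ≈⟨ +-cong {a · r} {a · r} {+ 0 ∷ (p *ₚ r)} {+ 0 ∷ (r *ₚ p)} (≈ₚ-refl {a · r}) (cons-cong ≡.refl (*-comm p r)) ⟩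
      a · r +ₚ (+ 0 ∷ (r *ₚ p))   ≈⟨ *-cons r a p ⟨
      r *ₚ (a ∷ p)                ∎

    *-cong : Congruent₂ _*ₚ_
    *-cong {p} {p'} {r} {r'} p≈p' r≈r' = begin
      p *ₚ r     ≈⟨ *-congʳ p r≈r' ⟩
      p *ₚ r'    ≈⟨ *-comm p r' ⟩
      r' *ₚ p    ≈⟨ *-congʳ r' p≈p' ⟩
      r' *ₚ p'   ≈⟨ *-comm r' p' ⟩
      p' *ₚ r'   ∎

    *-distribˡ : _*ₚ_ DistributesOverˡ _+ₚ_
    *-distribˡ []      r s = ≈ₚ-refl {[]}
    *-distribˡ (a ∷ p) r s = begin
      a · (r +ₚ s) +ₚ (+ 0 ∷ (p *ₚ (r +ₚ s)))
        ≈⟨ +-cong {a · (r +ₚ s)} {a · r +ₚ a · s} {+ 0 ∷ (p *ₚ (r +ₚ s))} {+ 0 ∷ ((p *ₚ r) +ₚ (p *ₚ s))} (·-+ a r s) (cons-cong ≡.refl (*-distribˡ p r s)) ⟩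
      (a · r +ₚ a · s) +ₚ ((+ 0 ∷ (p *ₚ r)) +ₚ (+ 0 ∷ (p *ₚ s)))
        ≈⟨ +-middleFour (a · r) (a · s) _ _ ⟩
      (a · r +ₚ (+ 0 ∷ (p *ₚ r))) +ₚ (a · s +ₚ (+ 0 ∷ (p *ₚ s))) ∎

    *-distribʳ : _*ₚ_ DistributesOverʳ _+ₚ_
    *-distribʳ = Consequences.comm∧distrˡ⇒distrʳ {_*ₚ_} {_+ₚ_} (λ {p p' r r'} → +-cong {p} {p'} {r} {r'}) *-comm *-distribˡ

    ·-* : ∀ a r s → ((a · r) *ₚ s) ≈ₚ (a · (r *ₚ s))
    ·-* a []      s = ≈ₚ-refl {[]}
    ·-* a (b ∷ r) s = begin
      (a ℤ.* b) · s +ₚ (+ 0 ∷ ((a · r) *ₚ s))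
        ≈⟨ +-cong {(a ℤ.* b) · s} {a · (b · s)} {+ 0 ∷ ((a · r) *ₚ s)} {a · (+ 0 ∷ (r *ₚ s))} (≈ₚ-sym {a · (b · s)} {(a ℤ.* b) · s} (·-· a b s)) (cons-cong (≡.sym (ℤ.*-zeroʳ a)) (·-* a r s)) ⟩
      a · (b · s) +ₚ a · (+ 0 ∷ (r *ₚ s))
        ≈⟨ ·-+ a (b · s) _ ⟨
      a · (b · s +ₚ (+ 0 ∷ (r *ₚ s)))   ∎

    q-* : ∀ t s → ((+ 0 ∷ t) *ₚ s) ≈ₚ (+ 0 ∷ (t *ₚ s))
    q-* t s = +-cong {(+ 0) · s} {[]} {+ 0 ∷ (t *ₚ s)} {+ 0 ∷ (t *ₚ s)} (0· s) (≈ₚ-refl {+ 0 ∷ (t *ₚ s)})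

    *-assoc : Associative _*ₚ_
    *-assoc []      r s = ≈ₚ-refl {[]}
    *-assoc (a ∷ p) r s = begin
      (a · r +ₚ (+ 0 ∷ (p *ₚ r))) *ₚ s
        ≈⟨ *-distribʳ s (a · r) _ ⟩
      ((a · r) *ₚ s) +ₚ ((+ 0 ∷ (p *ₚ r)) *ₚ s)
        ≈⟨ +-cong {(a · r) *ₚ s} {a · (r *ₚ s)} {(+ 0 ∷ (p *ₚ r)) *ₚ s} {+ 0 ∷ (p *ₚ (r *ₚ s))} (·-* a r s)
                  (≈ₚ-trans {(+ 0 ∷ (p *ₚ r)) *ₚ s} {+ 0 ∷ ((p *ₚ r) *ₚ s)} {+ 0 ∷ (p *ₚ (r *ₚ s))} (q-* (p *ₚ r) s) (cons-cong ≡.refl (*-assoc p r s))) ⟩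
      a · (r *ₚ s) +ₚ (+ 0 ∷ (p *ₚ (r *ₚ s))) ∎

  ℤ[q]-isCommutativeRing : IsCommutativeRing _+ₚ_ _*ₚ_ -ₚ_ 0ₚ 1ₚ
  ℤ[q]-isCommutativeRing = record
    { isRing = record
      { +-isAbelianGroup = record
        { isGroup = record
          { isMonoid = record
            { isSemigroup = record
              { isMagma = record { isEquivalence = ≈ₚ-isEquivalence ; ∙-cong = λ {p p' r r'} → +-cong {p} {p'} {r} {r'} }
              ; assoc = +-assoc }
            ; identity = Consequences.comm∧idˡ⇒id {_+ₚ_} +-comm +-identityˡ }
          ; inverse = Consequences.comm∧invˡ⇒inv {_+ₚ_} { -ₚ_} {0ₚ} +-comm -‿inverseˡ
          ; ⁻¹-cong = λ {p r} → -‿cong {p} {r} }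
        ; comm = +-comm }
      ; *-cong = λ {p p' r r'} → *-cong {p} {p'} {r} {r'}
      ; *-assoc = *-assoc
      ; *-identity = Consequences.comm∧idˡ⇒id {_*ₚ_} *-comm *-identityˡ
      ; distrib = *-distribˡ , *-distribʳ }
    ; *-comm = *-comm }

  ℤ[q]-ring : CommutativeRing 0ℓ 0ℓ
  ℤ[q]-ring = record { isCommutativeRing = ℤ[q]-isCommutativeRing }

open PolynomialRing
open import Data.Integer using (+_)
open QHermiteMoments ℤ[q]-ring qₚ
open import Algebra.Properties.Semiring.Exp (CommutativeRing.semiring ℤ[q]-ring) using (_^_)
open MatrixAlgebra ℤ[q]-ring using (⊗-cong)
open LinAlg ℤ[q] using (_⊗_)
open import Relation.Binary.Reasoning.Setoid polySetoid

q*ₚ : ∀ p → (qₚ *ₚ p) ≈ₚ (+ 0 ∷ p)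
q*ₚ p = ≈ₚ-trans {qₚ *ₚ p} {+ 0 ∷ (1ₚ *ₚ p)} {+ 0 ∷ p} (q-* 1ₚ p) (cons-cong ≡.refl (*-identityˡ p))

[]≈qint : ∀ k → [ k ] ≈ₚ qint k
[]≈qint zero    = ≈ₚ-refl {[]}
[]≈qint (suc k) = +-cong {1ₚ} {1ₚ} {qₚ *ₚ [ k ]} {+ 0 ∷ qint k} (≈ₚ-refl {1ₚ})
  (≈ₚ-trans {qₚ *ₚ [ k ]} {+ 0 ∷ [ k ]} {+ 0 ∷ qint k} (q*ₚ [ k ]) (cons-cong ≡.refl ([]≈qint k)))

^≡^ₚ : ∀ k → qₚ ^ k ≡ qₚ ^ₚ k
^≡^ₚ zero    = ≡.refl
^≡^ₚ (suc k) = ≡.cong (qₚ *ₚ_) (^≡^ₚ k)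

[]!≈qfact : ∀ k → [ k ]! ≈ₚ qfact k
[]!≈qfact zero    = ≈ₚ-refl {1ₚ}
[]!≈qfact (suc k) = *-cong {[ k ]!} {qfact k} {[ suc k ]} {qint (suc k)} ([]!≈qfact k) ([]≈qint (suc k))

PMq≈PM : ∀ m → PMq m ≈ₚ PM m
PMq≈PM zero          = ≈ₚ-refl {1ₚ}
PMq≈PM (suc zero)    = ≈ₚ-refl {[]}
PMq≈PM (suc (suc m)) = *-cong {PMq m} {PM m} {[ suc m ]} {qint (suc m)} (PMq≈PM m) ([]≈qint (suc m))

hankel≈PMMatrix : ∀ n i j → hankelMatrix (suc n) i j ≈ₚ PMMatrix n i j
hankel≈PMMatrix n i j = ≈ₚ-trans {μ m} {PMq m} {PM m} (μ-closed m) (PMq≈PM m)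
  where m = toℕ i ℕ.+ toℕ j

Λ≈diagonal : ∀ k → Λ k ≈ₚ ((qₚ ^ₚ (k C 2)) *ₚ qfact k)
Λ≈diagonal k = begin
  Λ k                                ≈⟨ Λ-closed k ⟩
  (qₚ ^ (k C 2)) *ₚ [ k ]!           ≡⟨ ≡.cong (_*ₚ [ k ]!) (^≡^ₚ (k C 2)) ⟩
  (qₚ ^ₚ (k C 2)) *ₚ [ k ]!          ≈⟨ *-congʳ (qₚ ^ₚ (k C 2)) {[ k ]!} {qfact k} ([]!≈qfact k) ⟩
  (qₚ ^ₚ (k C 2)) *ₚ qfact k         ∎

targetDiag-diagonal : ∀ n i → targetDiag n i i ≈ₚ Λ (toℕ i)
targetDiag-diagonal n i with i ≟ i
... | yes _   = ≈ₚ-sym {Λ (toℕ i)} {(qₚ ^ₚ (toℕ i C 2)) *ₚ qfact (toℕ i)} (Λ≈diagonal (toℕ i))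
... | no  i≢i = ⊥-elim (i≢i ≡.refl)

targetDiag-off-diagonal : ∀ n i j → i ≢ j → targetDiag n i j ≈ₚ 0ₚ
targetDiag-off-diagonal n i j i≢j with i ≟ j
... | yes i≡j = ⊥-elim (i≢j i≡j)
... | no  _   = ≈ₚ-refl {[]}

congruence-PMMatrix : ∀ n (i j : Fin (suc n)) →
  ((coefficientMatrix (suc n) ⊗ PMMatrix n) ⊗ flip (coefficientMatrix (suc n))) i j
    ≈ₚ ((coefficientMatrix (suc n) ⊗ hankelMatrix (suc n)) ⊗ flip (coefficientMatrix (suc n))) i j
congruence-PMMatrix n = ⊗-cong {A = L ⊗ PMMatrix n} {L ⊗ H} {flip L} {flip L}
  (⊗-cong {A = L} {L} {PMMatrix n} {H} (λ i k → ≈ₚ-refl {L i k}) (λ k l → ≈ₚ-sym {H k l} {PMMatrix n k l} (hankel≈PMMatrix n k l)))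
  (λ l j → ≈ₚ-refl {L j l})
  where
  L H : LinAlg.Matrix ℤ[q] (suc n) (suc n)
  L = coefficientMatrix (suc n)
  H = hankelMatrix (suc n)

PMMatrix-diagonalised : ∀ n (i j : Fin (suc n)) →
  ((coefficientMatrix (suc n) ⊗ PMMatrix n) ⊗ flip (coefficientMatrix (suc n))) i j ≈ₚ targetDiag n i j
PMMatrix-diagonalised n i j with i ≟ j
... | yes ≡.refl = begin
  ((L ⊗ PMMatrix n) ⊗ flip L) i i                ≈⟨ congruence-PMMatrix n i i ⟩
  ((L ⊗ hankelMatrix (suc n)) ⊗ flip L) i i      ≈⟨ congruence-diagonal (suc n) i ⟩
  Λ (toℕ i)                                      ≈⟨ Λ≈diagonal (toℕ i) ⟩
  (qₚ ^ₚ (toℕ i C 2)) *ₚ qfact (toℕ i)           ∎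
  where L = coefficientMatrix (suc n)
... | no i≢j = begin
  ((L ⊗ PMMatrix n) ⊗ flip L) i j                ≈⟨ congruence-PMMatrix n i j ⟩
  ((L ⊗ hankelMatrix (suc n)) ⊗ flip L) i j      ≈⟨ congruence-off-diagonal (suc n) i j (i≢j ∘ toℕ-injective) ⟩
  0ₚ                                             ∎
  where L = coefficientMatrix (suc n)

targetDiag-divides : ∀ n (i j i' j' : Fin (suc n)) → toℕ i ≡ toℕ i' → toℕ j ≡ toℕ j' → toℕ j ≤ toℕ i →
                     LinAlg._∣R_ ℤ[q] (targetDiag n j j') (targetDiag n i i')
targetDiag-divides n i j i' j' i≡i' j≡j' j≤i with toℕ-injective i≡i' | toℕ-injective j≡j' | Λ-divides j≤i
... | ≡.refl | ≡.refl | d , Λi≈dΛj = d , (begin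
  targetDiag n i i        ≈⟨ targetDiag-diagonal n i ⟩
  Λ (toℕ i)               ≈⟨ Λi≈dΛj ⟩
  d *ₚ Λ (toℕ j)          ≈⟨ *-congʳ d {Λ (toℕ j)} {targetDiag n j j} (≈ₚ-sym {targetDiag n j j} {Λ (toℕ j)} (targetDiag-diagonal n j)) ⟩
  d *ₚ targetDiag n j j   ∎)

corollary4p6 : (n : ℕ) → LinAlg.IsSSNF ℤ[q] (PMMatrix n) (targetDiag n)
corollary4p6 n =
  coefficientMatrix (suc n) , flip (coefficientMatrix (suc n)) ,
  coefficientMatrix-det (suc n) , coefficientMatrixᵀ-det (suc n) ,
  PMMatrix-diagonalised n ,
  (λ i j i≢j → targetDiag-off-diagonal n i j (i≢j ∘ ≡.cong toℕ)) ,
  targetDiag-divides n
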